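{- Let $(\mu_\circ,\eta_\circ,\delta_\circ,\epsilon_\circ)$ and $(\mu_\bullet,\eta_\bullet,\delta_\bullet,\epsilon_\bullet)$ form a GHZ/W-pair on an object $Q$ of a symmetric monoidal category $\mathbf V$, and assume $\{\eta_\bullet,\tau\circ\eta_\bullet\}$ is a plugging set for $Q$. For $\psi:I\to Q$ let $\Phi_\psi:=\mu_\circ\circ(1_Q\otimes\psi)$ and $\Phi_{1/\psi}:=\tau\circ\Phi_\psi\circ\tau$. Then $$\Phi_{1/\psi}\circ\Phi_\psi=(\epsilon_\bullet\circ\psi)\cdot(\epsilon_\bullet\circ\tau\circ\psi)\cdot 1_Q.$$
   Context: Let $(\mathbf V,\otimes,I,\sigma)$ be a symmetric monoidal category; scalars are morphisms $I\to I$ and $s\cdot f$ denotes $s\otimes f$ with $I\otimes X\cong X$. A commutative Frobenius algebra (CFA) on $Q$ is a commutative monoid $(Q,\mu,\eta)$ and cocommutative comonoid $(Q,\delta,\epsilon)$ with $(1\otimes\mu)(\delta\otimes 1)=\delta\mu=(\mu\otimes1)(1\otimes\delta)$. It is special if $\mu\circ\delta=1_Q$, and anti-special if $c\cdot(\mu\circ\delta)=(\mu\circ\delta\circ\eta)\circ(\epsilon\circ\mu\circ\delta)$ where $c=\epsilon\circ\mu\circ\delta\circ\eta$. A GHZ-structure is a special CFA $(\mu_\circ,\eta_\circ,\delta_\circ,\epsilon_\circ)$, a W-structure an anti-special CFA $(\mu_\bullet,\eta_\bullet,\delta_\bullet,\epsilon_\bullet)$, both on $Q$. Define $\tau:=(\epsilon_\bullet\mu_\bullet\otimes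 1_Q)\circ(1_Q\otimes\delta_\circ\eta_\circ):Q\to Q$. They form a GHZ/W-pair if: ($\alpha$) $\tau=(\epsilon_\circ\mu_\circ\otimes 1_Q)\circ(1_Q\otimes\delta_\bullet\eta_\bullet)$; ($\beta$) $\delta_\circ\circ\eta_\bullet=\eta_\bullet\otimes\eta_\bullet$; ($\gamma$) $\delta_\circ\circ\tau=(\tau\otimes\tau)\circ\delta_\circ$; ($\xi$) $(\epsilon_\bullet\mu_\bullet\delta_\bullet\eta_\bullet)\cdot(\tau\circ\eta_\bullet)=\mu_\bullet\circ\delta_\bullet\circ\eta_\bullet$. A set of points $\{\psi_i:I\to Q\}$ is a plugging set if for all objects $A$ and $f,g:Q\to A$, $f=g$ iff $f\circ\psi_i=g\circ\psi_i$ for all $i$. -}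

module Defs where

open import Level using (Level; suc; _⊔_)
open import Relation.Binary using (Rel; IsEquivalence)
open import Data.Product using (_×_)

record SymMonCat (o ℓ e : Level) : Set (suc (o ⊔ ℓ ⊔ e)) where
  infixr 9 _∘_
  infixr 10 _⊗₀_ _⊗₁_
  infix 4 _≈_
  field
    Obj : Set o
    _⇒_ : Obj → Obj → Set ℓ
    _≈_ : ∀ {A B} → Rel (A ⇒ B) e
    ≈-equiv : ∀ {A B} → IsEquivalence (_≈_ {A} {B})
    id : ∀ {A} → A ⇒ A
    _∘_ : ∀ {A B C} → B ⇒ C → A ⇒ B → A ⇒ C
    assoc : ∀ {A B C D} {f : A ⇒ B} {g : B ⇒ C} {h : C ⇒ D} →
            (h ∘ g) ∘ f ≈ h ∘ (g ∘ f)
    identityˡ : ∀ {A B} {f : A ⇒ B} → id ∘ f ≈ f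
    identityʳ : ∀ {A B} {f : A ⇒ B} → f ∘ id ≈ f
    ∘-resp-≈ : ∀ {A B C} {f h : B ⇒ C} {g i : A ⇒ B} →
               f ≈ h → g ≈ i → f ∘ g ≈ h ∘ i
    _⊗₀_ : Obj → Obj → Obj
    _⊗₁_ : ∀ {A B C D} → A ⇒ B → C ⇒ D → (A ⊗₀ C) ⇒ (B ⊗₀ D)
    ⊗-identity : ∀ {A C} → id {A} ⊗₁ id {C} ≈ id
    ⊗-homomorphism : ∀ {A B C D E F} {f : B ⇒ C} {g : A ⇒ B} {h : E ⇒ F} {i : D ⇒ E} →
                     (f ∘ g) ⊗₁ (h ∘ i) ≈ (f ⊗₁ h) ∘ (g ⊗₁ i)
    ⊗-resp-≈ : ∀ {A B C D} {f g : A ⇒ B} {h i : C ⇒ D} →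
               f ≈ g → h ≈ i → f ⊗₁ h ≈ g ⊗₁ i
    I : Obj
    unitorˡ⇒ : ∀ {A} → (I ⊗₀ A) ⇒ A
    unitorˡ⇐ : ∀ {A} → A ⇒ (I ⊗₀ A)
    unitorˡ-isoˡ : ∀ {A} → unitorˡ⇐ ∘ unitorˡ⇒ ≈ id {I ⊗₀ A}
    unitorˡ-isoʳ : ∀ {A} → unitorˡ⇒ ∘ unitorˡ⇐ ≈ id {A}
    unitorˡ-natural : ∀ {A B} {f : A ⇒ B} → f ∘ unitorˡ⇒ ≈ unitorˡ⇒ ∘ (id ⊗₁ f)
    unitorʳ⇒ : ∀ {A} → (A ⊗₀ I) ⇒ A
    unitorʳ⇐ : ∀ {A} → A ⇒ (A ⊗₀ I)
    unitorʳ-isoˡ : ∀ {A} → unitorʳ⇐ ∘ unitorʳ⇒ ≈ id {A ⊗₀ I}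
    unitorʳ-isoʳ : ∀ {A} → unitorʳ⇒ ∘ unitorʳ⇐ ≈ id {A}
    unitorʳ-natural : ∀ {A B} {f : A ⇒ B} → f ∘ unitorʳ⇒ ≈ unitorʳ⇒ ∘ (f ⊗₁ id)
    associator⇒ : ∀ {A B C} → ((A ⊗₀ B) ⊗₀ C) ⇒ (A ⊗₀ (B ⊗₀ C))
    associator⇐ : ∀ {A B C} → (A ⊗₀ (B ⊗₀ C)) ⇒ ((A ⊗₀ B) ⊗₀ C)
    associator-isoˡ : ∀ {A B C} → associator⇐ ∘ associator⇒ ≈ id {(A ⊗₀ B) ⊗₀ C}
    associator-isoʳ : ∀ {A B C} → associator⇒ ∘ associator⇐ ≈ id {A ⊗₀ (B ⊗₀ C)}
    associator-natural : ∀ {A B C D E F} {f : A ⇒ B} {g : C ⇒ D} {h : E ⇒ F} →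
                         associator⇒ ∘ ((f ⊗₁ g) ⊗₁ h) ≈ (f ⊗₁ (g ⊗₁ h)) ∘ associator⇒
    triangle : ∀ {A B} → (id {A} ⊗₁ unitorˡ⇒ {B}) ∘ associator⇒ ≈ unitorʳ⇒ ⊗₁ id
    pentagon : ∀ {A B C D} →
               (id {A} ⊗₁ associator⇒ {B} {C} {D}) ∘ associator⇒ ∘ (associator⇒ ⊗₁ id)
               ≈ associator⇒ ∘ associator⇒
    braiding : ∀ {A B} → (A ⊗₀ B) ⇒ (B ⊗₀ A)
    braiding-natural : ∀ {A B C D} {f : A ⇒ B} {g : C ⇒ D} →
                       braiding ∘ (f ⊗₁ g) ≈ (g ⊗₁ f) ∘ braiding
    commutative : ∀ {A B} → braiding {B} {A} ∘ braiding {A} {B} ≈ id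
    hexagon : ∀ {A B C} →
              associator⇒ {B} {C} {A} ∘ braiding ∘ associator⇒
              ≈ (id ⊗₁ braiding) ∘ associator⇒ ∘ (braiding ⊗₁ id)

module _ {o ℓ e} (V : SymMonCat o ℓ e) where
  open SymMonCat V

  infixr 8 _·_
  _·_ : ∀ {A B} → I ⇒ I → A ⇒ B → A ⇒ B
  s · f = unitorˡ⇒ ∘ (s ⊗₁ f) ∘ unitorˡ⇐

  record IsCFA (Q : Obj) (μ : (Q ⊗₀ Q) ⇒ Q) (η : I ⇒ Q)
               (δ : Q ⇒ (Q ⊗₀ Q)) (ε : Q ⇒ I) : Set e where
    field
      μ-assoc : μ ∘ (μ ⊗₁ id) ≈ μ ∘ (id ⊗₁ μ) ∘ associator⇒
      μ-unitˡ : μ ∘ (η ⊗₁ id) ≈ unitorˡ⇒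
      μ-unitʳ : μ ∘ (id ⊗₁ η) ≈ unitorʳ⇒
      μ-comm  : μ ∘ braiding ≈ μ
      δ-coassoc : associator⇒ ∘ (δ ⊗₁ id) ∘ δ ≈ (id ⊗₁ δ) ∘ δ
      δ-counitˡ : (ε ⊗₁ id) ∘ δ ≈ unitorˡ⇐
      δ-counitʳ : (id ⊗₁ ε) ∘ δ ≈ unitorʳ⇐
      δ-cocomm  : braiding ∘ δ ≈ δ
      frobeniusˡ : (id ⊗₁ μ) ∘ associator⇒ ∘ (δ ⊗₁ id) ≈ δ ∘ μ
      frobeniusʳ : (μ ⊗₁ id) ∘ associator⇐ ∘ (id ⊗₁ δ) ≈ δ ∘ μ

  IsSpecial : {Q : Obj} → (Q ⊗₀ Q) ⇒ Q → Q ⇒ (Q ⊗₀ Q) → Set e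
  IsSpecial μ δ = μ ∘ δ ≈ id

  IsAntiSpecial : {Q : Obj} → (Q ⊗₀ Q) ⇒ Q → I ⇒ Q → Q ⇒ (Q ⊗₀ Q) → Q ⇒ I → Set e
  IsAntiSpecial μ η δ ε =
    ((ε ∘ μ ∘ δ ∘ η) · (μ ∘ δ)) ≈ (μ ∘ δ ∘ η) ∘ (ε ∘ μ ∘ δ)

  mixed : {Q : Obj} → (Q ⊗₀ Q) ⇒ Q → Q ⇒ I → Q ⇒ (Q ⊗₀ Q) → I ⇒ Q → Q ⇒ Q
  mixed μ ε δ' η' =
    unitorˡ⇒ ∘ ((ε ∘ μ) ⊗₁ id) ∘ associator⇐ ∘ (id ⊗₁ (δ' ∘ η')) ∘ unitorʳ⇐

  record GHZWPair (Q : Obj)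
    (μ∘ : (Q ⊗₀ Q) ⇒ Q) (η∘ : I ⇒ Q) (δ∘ : Q ⇒ (Q ⊗₀ Q)) (ε∘ : Q ⇒ I)
    (μ• : (Q ⊗₀ Q) ⇒ Q) (η• : I ⇒ Q) (δ• : Q ⇒ (Q ⊗₀ Q)) (ε• : Q ⇒ I) : Set e where
    τ : Q ⇒ Q
    τ = mixed μ• ε• δ∘ η∘
    field
      ghz-cfa : IsCFA Q μ∘ η∘ δ∘ ε∘
      ghz-special : IsSpecial μ∘ δ∘
      w-cfa : IsCFA Q μ• η• δ• ε•
      w-antispecial : IsAntiSpecial μ• η• δ• ε•
      pair-α : τ ≈ mixed μ∘ ε∘ δ• η•
      pair-β : δ∘ ∘ η• ≈ (η• ⊗₁ η•) ∘ unitorˡ⇐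
      pair-γ : δ∘ ∘ τ ≈ (τ ⊗₁ τ) ∘ δ∘
      pair-ξ : ((ε• ∘ μ• ∘ δ• ∘ η•) · (τ ∘ η•)) ≈ μ• ∘ δ• ∘ η•

  τ-map : {Q : Obj} → (Q ⊗₀ Q) ⇒ Q → Q ⇒ I → Q ⇒ (Q ⊗₀ Q) → I ⇒ Q → Q ⇒ Q
  τ-map μ• ε• δ∘ η∘ = mixed μ• ε• δ∘ η∘

  IsPluggingSet₂ : {Q : Obj} → I ⇒ Q → I ⇒ Q → Set (o ⊔ ℓ ⊔ e)
  IsPluggingSet₂ {Q} ψ₁ ψ₂ = ∀ {A} (f g : Q ⇒ A) →
    (f ≈ g → (f ∘ ψ₁ ≈ g ∘ ψ₁) × (f ∘ ψ₂ ≈ g ∘ ψ₂)) ×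
    ((f ∘ ψ₁ ≈ g ∘ ψ₁) × (f ∘ ψ₂ ≈ g ∘ ψ₂) → f ≈ g)

  Φ : {Q : Obj} → (Q ⊗₀ Q) ⇒ Q → I ⇒ Q → Q ⇒ Q
  Φ μ ψ = μ ∘ (id ⊗₁ ψ) ∘ unitorʳ⇐

  Φinv : {Q : Obj} → (Q ⊗₀ Q) ⇒ Q → Q ⇒ Q → I ⇒ Q → Q ⇒ Q
  Φinv μ τ ψ = τ ∘ Φ μ ψ ∘ τ

-- Both sides are determined by their values at the plugging points η• and τ ∘ η•. Both points
-- are copyable for δ∘ (by β, and by γ), and in a Frobenius algebra μ∘ multiplies a copyable
-- point a by the scalar ε∘ ∘ μ∘ ∘ (a ⊗ ψ). With α and the zigzag identities these scalars are
-- ε• ∘ τ ∘ ψ at η• and ε• ∘ ψ at τ ∘ η•, so both points are eigenpoints of Φ_ψ. As τ is an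
-- involution swapping them, Φ_{1/ψ} ∘ Φ_ψ scales each by the product of the two eigenvalues,
-- and so does the right-hand side, scalars being commutative.
module Submission where

open import Defs
open import Level using (Level)
open import Data.Product using (_×_; _,_; proj₂)
open import Relation.Binary using (IsEquivalence; Setoid)
import Relation.Binary.Reasoning.Setoid as SetoidReasoning

module _ {o ℓ e} (V : SymMonCat o ℓ e) where
  open SymMonCat V

  hom-setoid : Obj → Obj → Setoid ℓ e
  hom-setoid A B = record { Carrier = A ⇒ B ; _≈_ = _≈_ ; isEquivalence = ≈-equiv }

  private
    module Equiv {A B : Obj} = IsEquivalence (≈-equiv {A} {B})
    module HomReasoning {A B : Obj} = SetoidReasoning (hom-setoid A B)
  open Equiv using (refl; sym; trans)
  open HomReasoning

  infixr 4 _⟩∘⟨_ _⟩⊗⟨_ refl⟩∘⟨_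
  infixl 5 _⟩∘⟨refl

  _⟩∘⟨_ : ∀ {A B C} {f h : B ⇒ C} {g i : A ⇒ B} → f ≈ h → g ≈ i → f ∘ g ≈ h ∘ i
  _⟩∘⟨_ = ∘-resp-≈

  _⟩⊗⟨_ : ∀ {A B C D} {f g : A ⇒ B} {h i : C ⇒ D} → f ≈ g → h ≈ i → f ⊗₁ h ≈ g ⊗₁ i
  _⟩⊗⟨_ = ⊗-resp-≈

  refl⟩∘⟨_ : ∀ {A B C} {f : B ⇒ C} {g i : A ⇒ B} → g ≈ i → f ∘ g ≈ f ∘ i
  refl⟩∘⟨ q = refl ⟩∘⟨ q

  _⟩∘⟨refl : ∀ {A B C} {f h : B ⇒ C} {g : A ⇒ B} → f ≈ h → f ∘ g ≈ h ∘ g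
  p ⟩∘⟨refl = p ⟩∘⟨ refl

  sym-assoc : ∀ {A B C D} {f : A ⇒ B} {g : B ⇒ C} {h : C ⇒ D} → h ∘ (g ∘ f) ≈ (h ∘ g) ∘ f
  sym-assoc = sym assoc

  pullˡ : ∀ {A B C D} {a : C ⇒ D} {b : B ⇒ C} {c : B ⇒ D} {f : A ⇒ B} →
          a ∘ b ≈ c → a ∘ (b ∘ f) ≈ c ∘ f
  pullˡ p = trans sym-assoc (p ⟩∘⟨refl)

  pullʳ : ∀ {A B C D} {a : B ⇒ C} {b : A ⇒ B} {c : A ⇒ C} {f : C ⇒ D} →
          a ∘ b ≈ c → (f ∘ a) ∘ b ≈ f ∘ c
  pullʳ p = trans assoc (refl⟩∘⟨ p)

  elimʳ : ∀ {A B} {f : A ⇒ B} {g : A ⇒ A} → g ≈ id → f ∘ g ≈ f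
  elimʳ p = trans (refl⟩∘⟨ p) identityʳ

  elimˡ : ∀ {A B} {f : A ⇒ B} {g : B ⇒ B} → g ≈ id → g ∘ f ≈ f
  elimˡ p = trans (p ⟩∘⟨refl) identityˡ

  splitEpi-cancelʳ : ∀ {A B C} {f g : B ⇒ C} {h : A ⇒ B} {h' : B ⇒ A} →
                     h ∘ h' ≈ id → f ∘ h ≈ g ∘ h → f ≈ g
  splitEpi-cancelʳ {f = f} {g} {h} {h'} inv p = begin
    f              ≈⟨ sym (elimʳ inv) ⟩
    f ∘ (h ∘ h')   ≈⟨ sym-assoc ⟩
    (f ∘ h) ∘ h'   ≈⟨ p ⟩∘⟨refl ⟩
    (g ∘ h) ∘ h'   ≈⟨ assoc ⟩
    g ∘ (h ∘ h')   ≈⟨ elimʳ inv ⟩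
    g              ∎

  splitMono-cancelˡ : ∀ {A B C} {f g : A ⇒ B} {h : B ⇒ C} {h' : C ⇒ B} →
                      h' ∘ h ≈ id → h ∘ f ≈ h ∘ g → f ≈ g
  splitMono-cancelˡ {f = f} {g} {h} {h'} inv p = begin
    f              ≈⟨ sym (elimˡ inv) ⟩
    (h' ∘ h) ∘ f   ≈⟨ assoc ⟩
    h' ∘ (h ∘ f)   ≈⟨ refl⟩∘⟨ p ⟩
    h' ∘ (h ∘ g)   ≈⟨ sym-assoc ⟩
    (h' ∘ h) ∘ g   ≈⟨ elimˡ inv ⟩
    g              ∎

  inverse-natural : ∀ {A B C D} {i : A ⇒ B} {j : B ⇒ A} {f : B ⇒ D} {g : A ⇒ C}
                      {i' : C ⇒ D} {j' : D ⇒ C} →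
                    j' ∘ i' ≈ id → i ∘ j ≈ id → f ∘ i ≈ i' ∘ g → j' ∘ f ≈ g ∘ j
  inverse-natural {i = i} {j} {f} {g} {i'} {j'} inv' inv p = begin
    j' ∘ f                 ≈⟨ sym (elimʳ inv) ⟩
    (j' ∘ f) ∘ (i ∘ j)     ≈⟨ trans assoc (refl⟩∘⟨ sym-assoc) ⟩
    j' ∘ ((f ∘ i) ∘ j)     ≈⟨ refl⟩∘⟨ p ⟩∘⟨refl ⟩
    j' ∘ ((i' ∘ g) ∘ j)    ≈⟨ refl⟩∘⟨ assoc ⟩
    j' ∘ (i' ∘ (g ∘ j))    ≈⟨ pullˡ inv' ⟩
    id ∘ (g ∘ j)           ≈⟨ identityˡ ⟩
    g ∘ j                  ∎

  unitorˡ⇐-natural : ∀ {A B} {f : A ⇒ B} → unitorˡ⇐ ∘ f ≈ (id ⊗₁ f) ∘ unitorˡ⇐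
  unitorˡ⇐-natural = inverse-natural unitorˡ-isoˡ unitorˡ-isoʳ unitorˡ-natural

  unitorʳ⇐-natural : ∀ {A B} {f : A ⇒ B} → unitorʳ⇐ ∘ f ≈ (f ⊗₁ id) ∘ unitorʳ⇐
  unitorʳ⇐-natural = inverse-natural unitorʳ-isoˡ unitorʳ-isoʳ unitorʳ-natural

  associator⇐-natural : ∀ {A B C D E F} {f : A ⇒ B} {g : C ⇒ D} {h : E ⇒ F} →
                        associator⇐ ∘ (f ⊗₁ (g ⊗₁ h)) ≈ ((f ⊗₁ g) ⊗₁ h) ∘ associator⇐
  associator⇐-natural =
    inverse-natural associator-isoˡ associator-isoʳ (sym associator-natural)

  serialize₁₂ : ∀ {A B C D} {f : A ⇒ B} {g : C ⇒ D} → f ⊗₁ g ≈ (f ⊗₁ id) ∘ (id ⊗₁ g)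
  serialize₁₂ = trans (sym identityʳ ⟩⊗⟨ sym identityˡ) ⊗-homomorphism

  serialize₂₁ : ∀ {A B C D} {f : A ⇒ B} {g : C ⇒ D} → f ⊗₁ g ≈ (id ⊗₁ g) ∘ (f ⊗₁ id)
  serialize₂₁ = trans (sym identityˡ ⟩⊗⟨ sym identityʳ) ⊗-homomorphism

  ⊗id-homomorphism : ∀ {A B C D} {f : B ⇒ C} {g : A ⇒ B} →
                     (f ∘ g) ⊗₁ id {D} ≈ (f ⊗₁ id) ∘ (g ⊗₁ id)
  ⊗id-homomorphism = trans (refl ⟩⊗⟨ sym identityˡ) ⊗-homomorphism

  id⊗-homomorphism : ∀ {A B C D} {f : B ⇒ C} {g : A ⇒ B} →
                     id {D} ⊗₁ (f ∘ g) ≈ (id ⊗₁ f) ∘ (id ⊗₁ g)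
  id⊗-homomorphism = trans (sym identityˡ ⟩⊗⟨ refl) ⊗-homomorphism

  ⊗-interchange : ∀ {A B C D} {f : A ⇒ B} {g : C ⇒ D} →
                  (f ⊗₁ id) ∘ (id ⊗₁ g) ≈ (id ⊗₁ g) ∘ (f ⊗₁ id)
  ⊗-interchange = trans (sym serialize₁₂) serialize₂₁

  ⊗id-inverse : ∀ {A B C} {f : A ⇒ B} {g : B ⇒ A} → f ∘ g ≈ id → (f ⊗₁ id {C}) ∘ (g ⊗₁ id) ≈ id
  ⊗id-inverse p = trans (sym ⊗-homomorphism) (trans (p ⟩⊗⟨ identityˡ) ⊗-identity)

  id⊗-inverse : ∀ {A B C} {f : A ⇒ B} {g : B ⇒ A} → f ∘ g ≈ id → (id {C} ⊗₁ f) ∘ (id ⊗₁ g) ≈ id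
  id⊗-inverse p = trans (sym ⊗-homomorphism) (trans (identityˡ ⟩⊗⟨ p) ⊗-identity)

  I⊗-faithful : ∀ {A B} {f g : A ⇒ B} → id {I} ⊗₁ f ≈ id ⊗₁ g → f ≈ g
  I⊗-faithful p = splitEpi-cancelʳ unitorˡ-isoʳ
    (trans unitorˡ-natural (trans (refl⟩∘⟨ p) (sym unitorˡ-natural)))

  ⊗I-faithful : ∀ {A B} {f g : A ⇒ B} → f ⊗₁ id {I} ≈ g ⊗₁ id → f ≈ g
  ⊗I-faithful p = splitEpi-cancelʳ unitorʳ-isoʳ
    (trans unitorʳ-natural (trans (refl⟩∘⟨ p) (sym unitorʳ-natural)))

  triangle-inverse : ∀ {A B} → associator⇒ ∘ (unitorʳ⇐ {A} ⊗₁ id {B}) ≈ id ⊗₁ unitorˡ⇐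
  triangle-inverse = begin
    associator⇒ ∘ (unitorʳ⇐ ⊗₁ id)
      ≈⟨ sym (elimˡ (id⊗-inverse unitorˡ-isoˡ)) ⟩
    ((id ⊗₁ unitorˡ⇐) ∘ (id ⊗₁ unitorˡ⇒)) ∘ (associator⇒ ∘ (unitorʳ⇐ ⊗₁ id))
      ≈⟨ trans assoc (refl⟩∘⟨ pullˡ triangle) ⟩
    (id ⊗₁ unitorˡ⇐) ∘ ((unitorʳ⇒ ⊗₁ id) ∘ (unitorʳ⇐ ⊗₁ id))
      ≈⟨ elimʳ (⊗id-inverse unitorʳ-isoʳ) ⟩
    id ⊗₁ unitorˡ⇐ ∎

  pentagon-inverse : ∀ {A B C D} →
    associator⇒ {A ⊗₀ B} {C} {D} ∘ (associator⇐ ⊗₁ id)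
      ≈ associator⇐ ∘ (id ⊗₁ associator⇒) ∘ associator⇒
  pentagon-inverse = sym (begin
    associator⇐ ∘ (id ⊗₁ associator⇒) ∘ associator⇒
      ≈⟨ sym (elimʳ (⊗id-inverse associator-isoʳ)) ⟩
    (associator⇐ ∘ (id ⊗₁ associator⇒) ∘ associator⇒) ∘ (associator⇒ ⊗₁ id) ∘ (associator⇐ ⊗₁ id)
      ≈⟨ trans assoc (refl⟩∘⟨ trans assoc (trans (refl⟩∘⟨ sym-assoc) sym-assoc)) ⟩
    associator⇐ ∘ ((id ⊗₁ associator⇒) ∘ associator⇒ ∘ (associator⇒ ⊗₁ id)) ∘ (associator⇐ ⊗₁ id)
      ≈⟨ refl⟩∘⟨ pentagon ⟩∘⟨refl ⟩
    associator⇐ ∘ (associator⇒ ∘ associator⇒) ∘ (associator⇐ ⊗₁ id)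
      ≈⟨ trans (refl⟩∘⟨ assoc) (pullˡ associator-isoˡ) ⟩
    id ∘ associator⇒ ∘ (associator⇐ ⊗₁ id)
      ≈⟨ identityˡ ⟩
    associator⇒ ∘ (associator⇐ ⊗₁ id) ∎)

  -- Kelly's consequences of the pentagon and triangle axioms.
  unitorˡ-associator : ∀ {A B} → unitorˡ⇒ {A ⊗₀ B} ∘ associator⇒ ≈ unitorˡ⇒ ⊗₁ id
  unitorˡ-associator {A} {B} = I⊗-faithful (splitEpi-cancelʳ pentagon-path-inverse (begin
    (id ⊗₁ (unitorˡ⇒ ∘ associator⇒)) ∘ pentagon-path
      ≈⟨ trans (id⊗-homomorphism ⟩∘⟨refl) assoc ⟩
    (id ⊗₁ unitorˡ⇒) ∘ (id ⊗₁ associator⇒) ∘ pentagon-path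
      ≈⟨ refl⟩∘⟨ pentagon ⟩
    (id ⊗₁ unitorˡ⇒) ∘ associator⇒ ∘ associator⇒
      ≈⟨ pullˡ triangle ⟩
    (unitorʳ⇒ ⊗₁ id) ∘ associator⇒
      ≈⟨ (refl ⟩⊗⟨ sym ⊗-identity) ⟩∘⟨refl ⟩
    (unitorʳ⇒ ⊗₁ (id ⊗₁ id)) ∘ associator⇒
      ≈⟨ sym associator-natural ⟩
    associator⇒ ∘ ((unitorʳ⇒ ⊗₁ id) ⊗₁ id)
      ≈⟨ refl⟩∘⟨ trans (sym triangle ⟩⊗⟨ refl) ⊗id-homomorphism ⟩
    associator⇒ ∘ ((id ⊗₁ unitorˡ⇒) ⊗₁ id) ∘ (associator⇒ ⊗₁ id)
      ≈⟨ trans (pullˡ associator-natural) assoc ⟩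
    (id ⊗₁ (unitorˡ⇒ ⊗₁ id)) ∘ pentagon-path ∎))
    where
      pentagon-path = associator⇒ {I} {I ⊗₀ A} {B} ∘ (associator⇒ ⊗₁ id)
      pentagon-path-inverse : pentagon-path ∘ (associator⇐ ⊗₁ id) ∘ associator⇐ ≈ id
      pentagon-path-inverse =
        trans assoc (trans (refl⟩∘⟨ pullˡ (⊗id-inverse associator-isoʳ))
                           (trans (refl⟩∘⟨ identityˡ) associator-isoʳ))

  unitorʳ-associator : ∀ {A B} → unitorʳ⇒ {A ⊗₀ B} ≈ (id ⊗₁ unitorʳ⇒) ∘ associator⇒
  unitorʳ-associator {A} {B} = ⊗I-faithful (splitMono-cancelˡ associator-isoˡ (begin
    associator⇒ ∘ (unitorʳ⇒ ⊗₁ id)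
      ≈⟨ refl⟩∘⟨ sym triangle ⟩
    associator⇒ ∘ (id ⊗₁ unitorˡ⇒) ∘ associator⇒
      ≈⟨ refl⟩∘⟨ (sym ⊗-identity ⟩⊗⟨ refl) ⟩∘⟨refl ⟩
    associator⇒ ∘ ((id ⊗₁ id) ⊗₁ unitorˡ⇒) ∘ associator⇒
      ≈⟨ trans (pullˡ associator-natural) assoc ⟩
    (id ⊗₁ (id ⊗₁ unitorˡ⇒)) ∘ associator⇒ ∘ associator⇒
      ≈⟨ refl⟩∘⟨ sym pentagon ⟩
    (id ⊗₁ (id ⊗₁ unitorˡ⇒)) ∘ (id ⊗₁ associator⇒) ∘ pentagon-path
      ≈⟨ pullˡ (trans (sym id⊗-homomorphism) (refl ⟩⊗⟨ triangle)) ⟩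
    (id ⊗₁ (unitorʳ⇒ ⊗₁ id)) ∘ pentagon-path
      ≈⟨ pullˡ (sym associator-natural) ⟩
    (associator⇒ ∘ ((id ⊗₁ unitorʳ⇒) ⊗₁ id)) ∘ (associator⇒ ⊗₁ id)
      ≈⟨ pullʳ (sym ⊗id-homomorphism) ⟩
    associator⇒ ∘ (((id ⊗₁ unitorʳ⇒) ∘ associator⇒) ⊗₁ id) ∎))
    where
      pentagon-path = associator⇒ {A} {B ⊗₀ I} {I} ∘ (associator⇒ ⊗₁ id)

  unitorʳ-associator⇐ : ∀ {A B} → unitorʳ⇒ {A ⊗₀ B} ∘ associator⇐ ≈ id ⊗₁ unitorʳ⇒
  unitorʳ-associator⇐ = trans (unitorʳ-associator ⟩∘⟨refl) (trans assoc (elimʳ associator-isoʳ))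

  associator⇐-unitorʳ⇐ : ∀ {A B} → associator⇐ ∘ (id ⊗₁ unitorʳ⇐) ≈ unitorʳ⇐ {A ⊗₀ B}
  associator⇐-unitorʳ⇐ = sym (splitMono-cancelˡ unitorʳ-isoˡ (begin
    unitorʳ⇒ ∘ unitorʳ⇐                                    ≈⟨ unitorʳ-isoʳ ⟩
    id                                                     ≈⟨ sym (id⊗-inverse unitorʳ-isoʳ) ⟩
    (id ⊗₁ unitorʳ⇒) ∘ (id ⊗₁ unitorʳ⇐)                    ≈⟨ sym unitorʳ-associator⇐ ⟩∘⟨refl ⟩
    (unitorʳ⇒ ∘ associator⇐) ∘ (id ⊗₁ unitorʳ⇐)            ≈⟨ assoc ⟩
    unitorʳ⇒ ∘ associator⇐ ∘ (id ⊗₁ unitorʳ⇐)              ∎))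

  unitorˡ≈unitorʳ : unitorˡ⇒ {I} ≈ unitorʳ⇒
  unitorˡ≈unitorʳ = ⊗I-faithful (begin
    unitorˡ⇒ ⊗₁ id                    ≈⟨ sym unitorˡ-associator ⟩
    unitorˡ⇒ ∘ associator⇒            ≈⟨ splitMono-cancelˡ unitorˡ-isoˡ unitorˡ-natural ⟩∘⟨refl ⟩
    (id ⊗₁ unitorˡ⇒) ∘ associator⇒    ≈⟨ triangle ⟩
    unitorʳ⇒ ⊗₁ id                    ∎)

  unitorˡ⇐≈unitorʳ⇐ : unitorˡ⇐ {I} ≈ unitorʳ⇐
  unitorˡ⇐≈unitorʳ⇐ = begin
    unitorˡ⇐                            ≈⟨ sym (elimʳ unitorʳ-isoʳ) ⟩
    unitorˡ⇐ ∘ unitorʳ⇒ ∘ unitorʳ⇐      ≈⟨ refl⟩∘⟨ sym unitorˡ≈unitorʳ ⟩∘⟨refl ⟩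
    unitorˡ⇐ ∘ unitorˡ⇒ ∘ unitorʳ⇐      ≈⟨ pullˡ unitorˡ-isoˡ ⟩
    id ∘ unitorʳ⇐                       ≈⟨ identityˡ ⟩
    unitorʳ⇐                            ∎

  unitorˡ-braiding : ∀ {A} → unitorˡ⇒ ∘ braiding {A} {I} ≈ unitorʳ⇒
  unitorˡ-braiding = ⊗I-faithful (splitMono-cancelˡ commutative (sym (begin
    braiding ∘ (unitorʳ⇒ ⊗₁ id)
      ≈⟨ refl⟩∘⟨ sym triangle ⟩
    braiding ∘ (id ⊗₁ unitorˡ⇒) ∘ associator⇒
      ≈⟨ trans (pullˡ braiding-natural) assoc ⟩
    (unitorˡ⇒ ⊗₁ id) ∘ braiding ∘ associator⇒
      ≈⟨ sym unitorˡ-associator ⟩∘⟨refl ⟩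
    (unitorˡ⇒ ∘ associator⇒) ∘ braiding ∘ associator⇒
      ≈⟨ trans assoc (refl⟩∘⟨ hexagon) ⟩
    unitorˡ⇒ ∘ (id ⊗₁ braiding) ∘ associator⇒ ∘ (braiding ⊗₁ id)
      ≈⟨ trans (pullˡ (sym unitorˡ-natural)) assoc ⟩
    braiding ∘ unitorˡ⇒ ∘ associator⇒ ∘ (braiding ⊗₁ id)
      ≈⟨ refl⟩∘⟨ pullˡ unitorˡ-associator ⟩
    braiding ∘ (unitorˡ⇒ ⊗₁ id) ∘ (braiding ⊗₁ id)
      ≈⟨ refl⟩∘⟨ sym ⊗id-homomorphism ⟩
    braiding ∘ ((unitorˡ⇒ ∘ braiding) ⊗₁ id) ∎)))

  braiding-unit : braiding {I} {I} ≈ id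
  braiding-unit = splitMono-cancelˡ unitorˡ-isoˡ
    (trans unitorˡ-braiding (trans (sym unitorˡ≈unitorʳ) (sym identityʳ)))

  infixr 8 _·ₛ_
  _·ₛ_ : ∀ {A B} → I ⇒ I → A ⇒ B → A ⇒ B
  _·ₛ_ = _·_ V

  scalar-via-id⊗ : {s : I ⇒ I} → s ≈ unitorˡ⇒ ∘ (id ⊗₁ s) ∘ unitorˡ⇐
  scalar-via-id⊗ {s} = begin
    s                                   ≈⟨ sym (elimʳ unitorˡ-isoʳ) ⟩
    s ∘ unitorˡ⇒ ∘ unitorˡ⇐             ≈⟨ trans sym-assoc (unitorˡ-natural ⟩∘⟨refl) ⟩
    (unitorˡ⇒ ∘ (id ⊗₁ s)) ∘ unitorˡ⇐   ≈⟨ assoc ⟩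
    unitorˡ⇒ ∘ (id ⊗₁ s) ∘ unitorˡ⇐     ∎

  scalar-via-⊗id : {s : I ⇒ I} → s ≈ unitorˡ⇒ ∘ (s ⊗₁ id) ∘ unitorˡ⇐
  scalar-via-⊗id {s} = begin
    s                                   ≈⟨ sym (elimʳ unitorʳ-isoʳ) ⟩
    s ∘ unitorʳ⇒ ∘ unitorʳ⇐             ≈⟨ trans sym-assoc (unitorʳ-natural ⟩∘⟨refl) ⟩
    (unitorʳ⇒ ∘ (s ⊗₁ id)) ∘ unitorʳ⇐   ≈⟨ assoc ⟩
    unitorʳ⇒ ∘ (s ⊗₁ id) ∘ unitorʳ⇐     ≈⟨ sym unitorˡ≈unitorʳ ⟩∘⟨ refl⟩∘⟨ sym unitorˡ⇐≈unitorʳ⇐ ⟩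
    unitorˡ⇒ ∘ (s ⊗₁ id) ∘ unitorˡ⇐     ∎

  unitorˡ-conjugate-∘ : ∀ {f g : (I ⊗₀ I) ⇒ (I ⊗₀ I)} →
    (unitorˡ⇒ ∘ f ∘ unitorˡ⇐) ∘ (unitorˡ⇒ ∘ g ∘ unitorˡ⇐) ≈ unitorˡ⇒ ∘ (f ∘ g) ∘ unitorˡ⇐
  unitorˡ-conjugate-∘ {f} {g} = begin
    (unitorˡ⇒ ∘ f ∘ unitorˡ⇐) ∘ (unitorˡ⇒ ∘ g ∘ unitorˡ⇐)   ≈⟨ trans assoc (refl⟩∘⟨ assoc) ⟩
    unitorˡ⇒ ∘ f ∘ unitorˡ⇐ ∘ unitorˡ⇒ ∘ g ∘ unitorˡ⇐       ≈⟨ refl⟩∘⟨ refl⟩∘⟨ pullˡ unitorˡ-isoˡ ⟩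
    unitorˡ⇒ ∘ f ∘ id ∘ g ∘ unitorˡ⇐                        ≈⟨ refl⟩∘⟨ refl⟩∘⟨ identityˡ ⟩
    unitorˡ⇒ ∘ f ∘ g ∘ unitorˡ⇐                             ≈⟨ refl⟩∘⟨ sym-assoc ⟩
    unitorˡ⇒ ∘ (f ∘ g) ∘ unitorˡ⇐                           ∎

  -- The Eckmann–Hilton argument.
  scalar-comm : {s t : I ⇒ I} → s ∘ t ≈ t ∘ s
  scalar-comm {s} {t} = begin
    s ∘ t                                                 ≈⟨ scalar-via-id⊗ ⟩∘⟨ scalar-via-⊗id ⟩
    (unitorˡ⇒ ∘ (id ⊗₁ s) ∘ unitorˡ⇐) ∘ (unitorˡ⇒ ∘ (t ⊗₁ id) ∘ unitorˡ⇐)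
                                                          ≈⟨ unitorˡ-conjugate-∘ ⟩
    unitorˡ⇒ ∘ ((id ⊗₁ s) ∘ (t ⊗₁ id)) ∘ unitorˡ⇐         ≈⟨ refl⟩∘⟨ sym ⊗-interchange ⟩∘⟨refl ⟩
    unitorˡ⇒ ∘ ((t ⊗₁ id) ∘ (id ⊗₁ s)) ∘ unitorˡ⇐         ≈⟨ sym unitorˡ-conjugate-∘ ⟩
    (unitorˡ⇒ ∘ (t ⊗₁ id) ∘ unitorˡ⇐) ∘ (unitorˡ⇒ ∘ (id ⊗₁ s) ∘ unitorˡ⇐)
                                                          ≈⟨ sym (scalar-via-⊗id ⟩∘⟨ scalar-via-id⊗) ⟩
    t ∘ s                                                 ∎

  ·ₛ-point : ∀ {A} {s : I ⇒ I} {x : I ⇒ A} → s ·ₛ x ≈ x ∘ s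
  ·ₛ-point {s = s} {x} = begin
    unitorˡ⇒ ∘ (s ⊗₁ x) ∘ unitorˡ⇐                   ≈⟨ refl⟩∘⟨ serialize₂₁ ⟩∘⟨refl ⟩
    unitorˡ⇒ ∘ ((id ⊗₁ x) ∘ (s ⊗₁ id)) ∘ unitorˡ⇐    ≈⟨ refl⟩∘⟨ assoc ⟩
    unitorˡ⇒ ∘ (id ⊗₁ x) ∘ (s ⊗₁ id) ∘ unitorˡ⇐      ≈⟨ trans (pullˡ (sym unitorˡ-natural)) assoc ⟩
    x ∘ unitorˡ⇒ ∘ (s ⊗₁ id) ∘ unitorˡ⇐              ≈⟨ refl⟩∘⟨ sym scalar-via-⊗id ⟩
    x ∘ s                                            ∎

  ·ₛ-∘ : ∀ {A B C} {s : I ⇒ I} {f : B ⇒ C} {g : A ⇒ B} → (s ·ₛ f) ∘ g ≈ s ·ₛ (f ∘ g)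
  ·ₛ-∘ {s = s} {f} {g} = begin
    (unitorˡ⇒ ∘ (s ⊗₁ f) ∘ unitorˡ⇐) ∘ g           ≈⟨ trans assoc (refl⟩∘⟨ assoc) ⟩
    unitorˡ⇒ ∘ (s ⊗₁ f) ∘ unitorˡ⇐ ∘ g             ≈⟨ refl⟩∘⟨ refl⟩∘⟨ unitorˡ⇐-natural ⟩
    unitorˡ⇒ ∘ (s ⊗₁ f) ∘ (id ⊗₁ g) ∘ unitorˡ⇐     ≈⟨ refl⟩∘⟨ pullˡ (sym ⊗-homomorphism) ⟩
    unitorˡ⇒ ∘ ((s ∘ id) ⊗₁ (f ∘ g)) ∘ unitorˡ⇐    ≈⟨ refl⟩∘⟨ (identityʳ ⟩⊗⟨ refl) ⟩∘⟨refl ⟩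
    unitorˡ⇒ ∘ (s ⊗₁ (f ∘ g)) ∘ unitorˡ⇐           ∎

  ·ₛ-·ₛ-id-point : ∀ {A} {s t : I ⇒ I} {x : I ⇒ A} → (s ·ₛ t ·ₛ id) ∘ x ≈ x ∘ (t ∘ s)
  ·ₛ-·ₛ-id-point {s = s} {t} {x} = begin
    (s ·ₛ t ·ₛ id) ∘ x   ≈⟨ ·ₛ-∘ ⟩
    s ·ₛ (t ·ₛ id) ∘ x   ≈⟨ refl⟩∘⟨ (refl ⟩⊗⟨ trans ·ₛ-∘ (refl⟩∘⟨ (refl ⟩⊗⟨ identityˡ) ⟩∘⟨refl)) ⟩∘⟨refl ⟩
    s ·ₛ t ·ₛ x          ≈⟨ ·ₛ-point ⟩
    (t ·ₛ x) ∘ s         ≈⟨ ·ₛ-point ⟩∘⟨refl ⟩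
    (x ∘ t) ∘ s          ≈⟨ assoc ⟩
    x ∘ t ∘ s            ∎

  -- mixed μ ε δ η is transposeˡ (ε ∘ μ) (δ ∘ η) definitionally.
  transposeˡ : ∀ {X} → (X ⊗₀ X) ⇒ I → I ⇒ (X ⊗₀ X) → X ⇒ X
  transposeˡ w c = unitorˡ⇒ ∘ (w ⊗₁ id) ∘ associator⇐ ∘ (id ⊗₁ c) ∘ unitorʳ⇐

  transposeʳ : ∀ {X} → (X ⊗₀ X) ⇒ I → I ⇒ (X ⊗₀ X) → X ⇒ X
  transposeʳ w c = unitorʳ⇒ ∘ (id ⊗₁ w) ∘ associator⇒ ∘ (c ⊗₁ id) ∘ unitorˡ⇐

  transposeˡ-∘ : ∀ {X} {w : (X ⊗₀ X) ⇒ I} {c : I ⇒ (X ⊗₀ X)} {f : X ⇒ X} →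
                 transposeˡ w c ∘ f ≈ transposeˡ (w ∘ (f ⊗₁ id)) c
  transposeˡ-∘ {w = w} {c} {f} = begin
    transposeˡ w c ∘ f
      ≈⟨ trans assoc (refl⟩∘⟨ trans assoc (refl⟩∘⟨ trans assoc (refl⟩∘⟨ assoc))) ⟩
    unitorˡ⇒ ∘ (w ⊗₁ id) ∘ associator⇐ ∘ (id ⊗₁ c) ∘ unitorʳ⇐ ∘ f
      ≈⟨ refl⟩∘⟨ refl⟩∘⟨ refl⟩∘⟨ refl⟩∘⟨ unitorʳ⇐-natural ⟩
    unitorˡ⇒ ∘ (w ⊗₁ id) ∘ associator⇐ ∘ (id ⊗₁ c) ∘ (f ⊗₁ id) ∘ unitorʳ⇐
      ≈⟨ refl⟩∘⟨ refl⟩∘⟨ refl⟩∘⟨ pullˡ (sym ⊗-interchange) ⟩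
    unitorˡ⇒ ∘ (w ⊗₁ id) ∘ associator⇐ ∘ ((f ⊗₁ id) ∘ (id ⊗₁ c)) ∘ unitorʳ⇐
      ≈⟨ refl⟩∘⟨ refl⟩∘⟨ trans (refl⟩∘⟨ assoc) sym-assoc ⟩
    unitorˡ⇒ ∘ (w ⊗₁ id) ∘ (associator⇐ ∘ (f ⊗₁ id)) ∘ (id ⊗₁ c) ∘ unitorʳ⇐
      ≈⟨ refl⟩∘⟨ refl⟩∘⟨ trans (move-associator ⟩∘⟨refl) assoc ⟩
    unitorˡ⇒ ∘ (w ⊗₁ id) ∘ ((f ⊗₁ id) ⊗₁ id) ∘ associator⇐ ∘ (id ⊗₁ c) ∘ unitorʳ⇐
      ≈⟨ refl⟩∘⟨ pullˡ (sym ⊗id-homomorphism) ⟩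
    transposeˡ (w ∘ (f ⊗₁ id)) c ∎
    where
      move-associator : associator⇐ ∘ (f ⊗₁ id) ≈ ((f ⊗₁ id) ⊗₁ id) ∘ associator⇐
      move-associator = trans (refl⟩∘⟨ (refl ⟩⊗⟨ sym ⊗-identity)) associator⇐-natural

  transposeˡ-unbend : ∀ {X} {w k : (X ⊗₀ X) ⇒ I} {c : I ⇒ (X ⊗₀ X)} →
                      transposeʳ k c ≈ id → k ∘ (transposeˡ w c ⊗₁ id) ≈ w
  transposeˡ-unbend {X} {w} {k} {c} zigzag = begin
    k ∘ (transposeˡ w c ⊗₁ id)
      ≈⟨ refl⟩∘⟨ trans ⊗id-homomorphism (refl⟩∘⟨ trans ⊗id-homomorphism
                   (refl⟩∘⟨ trans ⊗id-homomorphism (refl⟩∘⟨ ⊗id-homomorphism))) ⟩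
    k ∘ (unitorˡ⇒ ⊗₁ id) ∘ ((w ⊗₁ id) ⊗₁ id) ∘ bend
      ≈⟨ refl⟩∘⟨ sym unitorˡ-associator ⟩∘⟨refl ⟩
    k ∘ (unitorˡ⇒ ∘ associator⇒) ∘ ((w ⊗₁ id) ⊗₁ id) ∘ bend
      ≈⟨ trans (refl⟩∘⟨ assoc) sym-assoc ⟩
    (k ∘ unitorˡ⇒) ∘ associator⇒ ∘ ((w ⊗₁ id) ⊗₁ id) ∘ bend
      ≈⟨ unitorˡ-natural ⟩∘⟨ pullˡ associator-natural ⟩
    (unitorˡ⇒ ∘ (id ⊗₁ k)) ∘ ((w ⊗₁ (id ⊗₁ id)) ∘ associator⇒) ∘ bend
      ≈⟨ trans assoc (refl⟩∘⟨ trans (refl⟩∘⟨ assoc) (trans (pullˡ (trans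
           (refl⟩∘⟨ (refl ⟩⊗⟨ ⊗-identity)) (sym ⊗-interchange))) assoc)) ⟩
    unitorˡ⇒ ∘ (w ⊗₁ id) ∘ (id ⊗₁ k) ∘ associator⇒ ∘ bend
      ≈⟨ refl⟩∘⟨ refl⟩∘⟨ refl⟩∘⟨ pullˡ pentagon-inverse ⟩
    unitorˡ⇒ ∘ (w ⊗₁ id) ∘ (id ⊗₁ k) ∘ (associator⇐ ∘ (id ⊗₁ associator⇒) ∘ associator⇒)
      ∘ ((id ⊗₁ c) ⊗₁ id) ∘ (unitorʳ⇐ ⊗₁ id)
      ≈⟨ refl⟩∘⟨ refl⟩∘⟨ refl⟩∘⟨ trans assoc (refl⟩∘⟨ trans assoc
           (refl⟩∘⟨ trans (pullˡ associator-natural) (trans assoc (refl⟩∘⟨ triangle-inverse)))) ⟩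
    unitorˡ⇒ ∘ (w ⊗₁ id) ∘ (id ⊗₁ k) ∘ associator⇐ ∘ bend′
      ≈⟨ refl⟩∘⟨ refl⟩∘⟨ pullˡ (trans ((sym ⊗-identity ⟩⊗⟨ refl) ⟩∘⟨refl) (sym associator⇐-natural)) ⟩
    unitorˡ⇒ ∘ (w ⊗₁ id) ∘ (associator⇐ ∘ (id ⊗₁ (id ⊗₁ k))) ∘ bend′
      ≈⟨ unitorˡ≈unitorʳ ⟩∘⟨refl ⟩
    unitorʳ⇒ ∘ (w ⊗₁ id) ∘ (associator⇐ ∘ (id ⊗₁ (id ⊗₁ k))) ∘ bend′
      ≈⟨ pullˡ (sym unitorʳ-natural) ⟩
    (w ∘ unitorʳ⇒) ∘ (associator⇐ ∘ (id ⊗₁ (id ⊗₁ k))) ∘ bend′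
      ≈⟨ trans assoc (refl⟩∘⟨ trans (refl⟩∘⟨ assoc) (pullˡ unitorʳ-associator⇐)) ⟩
    w ∘ (id ⊗₁ unitorʳ⇒) ∘ (id ⊗₁ (id ⊗₁ k)) ∘ bend′
      ≈⟨ refl⟩∘⟨ sym (trans id⊗-homomorphism (refl⟩∘⟨ trans id⊗-homomorphism
           (refl⟩∘⟨ trans id⊗-homomorphism (refl⟩∘⟨ id⊗-homomorphism)))) ⟩
    w ∘ (id ⊗₁ transposeʳ k c)
      ≈⟨ elimʳ (trans (refl ⟩⊗⟨ zigzag) ⊗-identity) ⟩
    w ∎
    where
      bend = (associator⇐ ⊗₁ id) ∘ ((id ⊗₁ c) ⊗₁ id) ∘ (unitorʳ⇐ {X} ⊗₁ id {X})
      bend′ = (id ⊗₁ associator⇒) ∘ (id ⊗₁ (c ⊗₁ id)) ∘ (id {X} ⊗₁ unitorˡ⇐ {X})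

  transposeˡ-postcompose : ∀ {X} {w : (X ⊗₀ X) ⇒ I} {c : I ⇒ (X ⊗₀ X)} {e : X ⇒ I} {x : I ⇒ X} →
    (id ⊗₁ e) ∘ c ≈ unitorʳ⇐ ∘ x → e ∘ transposeˡ w c ≈ w ∘ (id ⊗₁ x) ∘ unitorʳ⇐
  transposeˡ-postcompose {w = w} {c} {e} {x} contract = begin
    e ∘ unitorˡ⇒ ∘ (w ⊗₁ id) ∘ associator⇐ ∘ (id ⊗₁ c) ∘ unitorʳ⇐
      ≈⟨ trans (pullˡ unitorˡ-natural) assoc ⟩
    unitorˡ⇒ ∘ (id ⊗₁ e) ∘ (w ⊗₁ id) ∘ associator⇐ ∘ (id ⊗₁ c) ∘ unitorʳ⇐
      ≈⟨ refl⟩∘⟨ trans (pullˡ (sym ⊗-interchange)) assoc ⟩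
    unitorˡ⇒ ∘ (w ⊗₁ id) ∘ (id ⊗₁ e) ∘ associator⇐ ∘ (id ⊗₁ c) ∘ unitorʳ⇐
      ≈⟨ refl⟩∘⟨ refl⟩∘⟨ trans (pullˡ (trans ((sym ⊗-identity ⟩⊗⟨ refl) ⟩∘⟨refl)
                                               (sym associator⇐-natural))) assoc ⟩
    unitorˡ⇒ ∘ (w ⊗₁ id) ∘ associator⇐ ∘ (id ⊗₁ (id ⊗₁ e)) ∘ (id ⊗₁ c) ∘ unitorʳ⇐
      ≈⟨ refl⟩∘⟨ refl⟩∘⟨ refl⟩∘⟨ pullˡ (trans (sym id⊗-homomorphism)
                                              (trans (refl ⟩⊗⟨ contract) id⊗-homomorphism)) ⟩
    unitorˡ⇒ ∘ (w ⊗₁ id) ∘ associator⇐ ∘ ((id ⊗₁ unitorʳ⇐) ∘ (id ⊗₁ x)) ∘ unitorʳ⇐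
      ≈⟨ refl⟩∘⟨ refl⟩∘⟨ trans (refl⟩∘⟨ assoc) (pullˡ associator⇐-unitorʳ⇐) ⟩
    unitorˡ⇒ ∘ (w ⊗₁ id) ∘ unitorʳ⇐ ∘ (id ⊗₁ x) ∘ unitorʳ⇐
      ≈⟨ refl⟩∘⟨ pullˡ (sym unitorʳ⇐-natural) ⟩
    unitorˡ⇒ ∘ (unitorʳ⇐ ∘ w) ∘ (id ⊗₁ x) ∘ unitorʳ⇐
      ≈⟨ trans (refl⟩∘⟨ assoc) (pullˡ (trans (unitorˡ≈unitorʳ ⟩∘⟨refl) unitorʳ-isoʳ)) ⟩
    id ∘ w ∘ (id ⊗₁ x) ∘ unitorʳ⇐
      ≈⟨ identityˡ ⟩
    w ∘ (id ⊗₁ x) ∘ unitorʳ⇐ ∎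

  Copyable : ∀ {Q} → Q ⇒ (Q ⊗₀ Q) → I ⇒ Q → Set e
  Copyable δ a = δ ∘ a ≈ (a ⊗₁ a) ∘ unitorˡ⇐

  module Frobenius {Q : Obj} {μ : (Q ⊗₀ Q) ⇒ Q} {η : I ⇒ Q} {δ : Q ⇒ (Q ⊗₀ Q)} {ε : Q ⇒ I}
                   (cfa : IsCFA V Q μ η δ ε) where
    open IsCFA cfa

    zigzagˡ : transposeˡ (ε ∘ μ) (δ ∘ η) ≈ id
    zigzagˡ = begin
      unitorˡ⇒ ∘ ((ε ∘ μ) ⊗₁ id) ∘ associator⇐ ∘ (id ⊗₁ (δ ∘ η)) ∘ unitorʳ⇐
        ≈⟨ refl⟩∘⟨ ⊗id-homomorphism ⟩∘⟨ refl⟩∘⟨ id⊗-homomorphism ⟩∘⟨refl ⟩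
      unitorˡ⇒ ∘ ((ε ⊗₁ id) ∘ (μ ⊗₁ id)) ∘ associator⇐ ∘ ((id ⊗₁ δ) ∘ (id ⊗₁ η)) ∘ unitorʳ⇐
        ≈⟨ refl⟩∘⟨ trans assoc (refl⟩∘⟨ trans (refl⟩∘⟨ trans (refl⟩∘⟨ assoc) sym-assoc) sym-assoc) ⟩
      unitorˡ⇒ ∘ (ε ⊗₁ id) ∘ ((μ ⊗₁ id) ∘ associator⇐ ∘ (id ⊗₁ δ)) ∘ (id ⊗₁ η) ∘ unitorʳ⇐
        ≈⟨ refl⟩∘⟨ refl⟩∘⟨ frobeniusʳ ⟩∘⟨refl ⟩
      unitorˡ⇒ ∘ (ε ⊗₁ id) ∘ (δ ∘ μ) ∘ (id ⊗₁ η) ∘ unitorʳ⇐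
        ≈⟨ refl⟩∘⟨ refl⟩∘⟨ trans assoc (refl⟩∘⟨ pullˡ μ-unitʳ) ⟩
      unitorˡ⇒ ∘ (ε ⊗₁ id) ∘ δ ∘ unitorʳ⇒ ∘ unitorʳ⇐
        ≈⟨ refl⟩∘⟨ pullˡ δ-counitˡ ⟩
      unitorˡ⇒ ∘ unitorˡ⇐ ∘ unitorʳ⇒ ∘ unitorʳ⇐
        ≈⟨ trans (pullˡ unitorˡ-isoʳ) (trans identityˡ unitorʳ-isoʳ) ⟩
      id ∎

    zigzagʳ : transposeʳ (ε ∘ μ) (δ ∘ η) ≈ id
    zigzagʳ = begin
      unitorʳ⇒ ∘ (id ⊗₁ (ε ∘ μ)) ∘ associator⇒ ∘ ((δ ∘ η) ⊗₁ id) ∘ unitorˡ⇐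
        ≈⟨ refl⟩∘⟨ id⊗-homomorphism ⟩∘⟨ refl⟩∘⟨ ⊗id-homomorphism ⟩∘⟨refl ⟩
      unitorʳ⇒ ∘ ((id ⊗₁ ε) ∘ (id ⊗₁ μ)) ∘ associator⇒ ∘ ((δ ⊗₁ id) ∘ (η ⊗₁ id)) ∘ unitorˡ⇐
        ≈⟨ refl⟩∘⟨ trans assoc (refl⟩∘⟨ trans (refl⟩∘⟨ trans (refl⟩∘⟨ assoc) sym-assoc) sym-assoc) ⟩
      unitorʳ⇒ ∘ (id ⊗₁ ε) ∘ ((id ⊗₁ μ) ∘ associator⇒ ∘ (δ ⊗₁ id)) ∘ (η ⊗₁ id) ∘ unitorˡ⇐
        ≈⟨ refl⟩∘⟨ refl⟩∘⟨ frobeniusˡ ⟩∘⟨refl ⟩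
      unitorʳ⇒ ∘ (id ⊗₁ ε) ∘ (δ ∘ μ) ∘ (η ⊗₁ id) ∘ unitorˡ⇐
        ≈⟨ refl⟩∘⟨ refl⟩∘⟨ trans assoc (refl⟩∘⟨ pullˡ μ-unitˡ) ⟩
      unitorʳ⇒ ∘ (id ⊗₁ ε) ∘ δ ∘ unitorˡ⇒ ∘ unitorˡ⇐
        ≈⟨ refl⟩∘⟨ pullˡ δ-counitʳ ⟩
      unitorʳ⇒ ∘ unitorʳ⇐ ∘ unitorˡ⇒ ∘ unitorˡ⇐
        ≈⟨ trans (pullˡ unitorʳ-isoʳ) (trans identityˡ unitorˡ-isoʳ) ⟩
      id ∎

    -- Insert the counit, trade δ ∘ μ for μ acting on the second leg of δ (Frobenius), copy a.
    μ-copyable : ∀ {a ψ : I ⇒ Q} → Copyable δ a → μ ∘ (a ⊗₁ ψ) ≈ a ∘ ε ∘ μ ∘ (a ⊗₁ ψ)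
    μ-copyable {a} {ψ} copy = begin
      p
        ≈⟨ trans (sym (elimˡ unitorʳ-isoʳ)) assoc ⟩
      unitorʳ⇒ ∘ unitorʳ⇐ ∘ p
        ≈⟨ refl⟩∘⟨ trans (sym δ-counitʳ ⟩∘⟨refl) assoc ⟩
      unitorʳ⇒ ∘ (id ⊗₁ ε) ∘ δ ∘ μ ∘ (a ⊗₁ ψ)
        ≈⟨ refl⟩∘⟨ refl⟩∘⟨ trans (pullˡ (sym frobeniusˡ)) (trans assoc (refl⟩∘⟨ assoc)) ⟩
      unitorʳ⇒ ∘ (id ⊗₁ ε) ∘ (id ⊗₁ μ) ∘ associator⇒ ∘ (δ ⊗₁ id) ∘ (a ⊗₁ ψ)
        ≈⟨ refl⟩∘⟨ refl⟩∘⟨ refl⟩∘⟨ refl⟩∘⟨ trans (sym ⊗-homomorphism)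
             (trans (copy ⟩⊗⟨ trans identityˡ (sym identityʳ)) ⊗-homomorphism) ⟩
      unitorʳ⇒ ∘ (id ⊗₁ ε) ∘ (id ⊗₁ μ) ∘ associator⇒ ∘ ((a ⊗₁ a) ⊗₁ ψ) ∘ (unitorˡ⇐ ⊗₁ id)
        ≈⟨ refl⟩∘⟨ refl⟩∘⟨ refl⟩∘⟨ pullˡ associator-natural ⟩
      unitorʳ⇒ ∘ (id ⊗₁ ε) ∘ (id ⊗₁ μ) ∘ ((a ⊗₁ (a ⊗₁ ψ)) ∘ associator⇒) ∘ (unitorˡ⇐ ⊗₁ id)
        ≈⟨ refl⟩∘⟨ refl⟩∘⟨ trans (pullˡ (pullˡ (trans (sym ⊗-homomorphism) (identityˡ ⟩⊗⟨ refl))))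
                                  assoc ⟩
      unitorʳ⇒ ∘ (id ⊗₁ ε) ∘ (a ⊗₁ p) ∘ associator⇒ ∘ (unitorˡ⇐ ⊗₁ id)
        ≈⟨ refl⟩∘⟨ trans (pullˡ (trans (sym ⊗-homomorphism) (trans (identityˡ ⟩⊗⟨ refl) serialize₁₂)))
                         assoc ⟩
      unitorʳ⇒ ∘ (a ⊗₁ id) ∘ (id ⊗₁ (ε ∘ p)) ∘ associator⇒ ∘ (unitorˡ⇐ ⊗₁ id)
        ≈⟨ trans (pullˡ (sym unitorʳ-natural)) (trans assoc (refl⟩∘⟨ sym unitorˡ≈unitorʳ ⟩∘⟨refl)) ⟩
      a ∘ unitorˡ⇒ ∘ (id ⊗₁ (ε ∘ p)) ∘ associator⇒ ∘ (unitorˡ⇐ ⊗₁ id)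
        ≈⟨ refl⟩∘⟨ trans (pullˡ (sym unitorˡ-natural)) (trans assoc (refl⟩∘⟨ pullˡ unitorˡ-associator)) ⟩
      a ∘ (ε ∘ p) ∘ (unitorˡ⇒ ⊗₁ id) ∘ (unitorˡ⇐ ⊗₁ id)
        ≈⟨ refl⟩∘⟨ elimʳ (⊗id-inverse unitorˡ-isoʳ) ⟩
      a ∘ ε ∘ p ∎
      where p = μ ∘ (a ⊗₁ ψ)

    Φ-copyable : ∀ {a ψ : I ⇒ Q} → Copyable δ a →
                 Φ V μ ψ ∘ a ≈ a ∘ (ε ∘ μ) ∘ (a ⊗₁ ψ) ∘ unitorʳ⇐
    Φ-copyable {a} {ψ} copy = begin
      (μ ∘ (id ⊗₁ ψ) ∘ unitorʳ⇐) ∘ a      ≈⟨ trans assoc (refl⟩∘⟨ assoc) ⟩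
      μ ∘ (id ⊗₁ ψ) ∘ unitorʳ⇐ ∘ a        ≈⟨ refl⟩∘⟨ refl⟩∘⟨ unitorʳ⇐-natural ⟩
      μ ∘ (id ⊗₁ ψ) ∘ (a ⊗₁ id) ∘ unitorʳ⇐
        ≈⟨ refl⟩∘⟨ pullˡ (trans (sym ⊗-homomorphism) (identityˡ ⟩⊗⟨ identityʳ)) ⟩
      μ ∘ (a ⊗₁ ψ) ∘ unitorʳ⇐             ≈⟨ sym-assoc ⟩
      (μ ∘ (a ⊗₁ ψ)) ∘ unitorʳ⇐           ≈⟨ μ-copyable copy ⟩∘⟨refl ⟩
      (a ∘ ε ∘ μ ∘ (a ⊗₁ ψ)) ∘ unitorʳ⇐   ≈⟨ trans assoc (refl⟩∘⟨ trans assoc (trans (refl⟩∘⟨ assoc) sym-assoc)) ⟩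
      a ∘ (ε ∘ μ) ∘ (a ⊗₁ ψ) ∘ unitorʳ⇐   ∎

  conjugate-eigenpoints : ∀ {Q} {τ F : Q ⇒ Q} {x y : I ⇒ Q} {s t : I ⇒ I} →
    τ ∘ x ≈ y → τ ∘ y ≈ x → F ∘ x ≈ x ∘ t → F ∘ y ≈ y ∘ s →
    ((τ ∘ F ∘ τ) ∘ F) ∘ x ≈ x ∘ s ∘ t
  conjugate-eigenpoints {τ = τ} {F} {x} {y} {s} {t} τx τy Fx Fy = begin
    ((τ ∘ F ∘ τ) ∘ F) ∘ x      ≈⟨ trans assoc (refl⟩∘⟨ Fx) ⟩
    (τ ∘ F ∘ τ) ∘ x ∘ t        ≈⟨ trans assoc (refl⟩∘⟨ trans assoc (refl⟩∘⟨ pullˡ τx)) ⟩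
    τ ∘ F ∘ y ∘ t              ≈⟨ refl⟩∘⟨ pullˡ Fy ⟩
    τ ∘ (y ∘ s) ∘ t            ≈⟨ refl⟩∘⟨ assoc ⟩
    τ ∘ y ∘ s ∘ t              ≈⟨ pullˡ τy ⟩
    x ∘ s ∘ t                  ∎

  module GHZWPairProperties
    {Q : Obj}
    {μ∘ : (Q ⊗₀ Q) ⇒ Q} {η∘ : I ⇒ Q} {δ∘ : Q ⇒ (Q ⊗₀ Q)} {ε∘ : Q ⇒ I}
    {μ• : (Q ⊗₀ Q) ⇒ Q} {η• : I ⇒ Q} {δ• : Q ⇒ (Q ⊗₀ Q)} {ε• : Q ⇒ I}
    (pair : GHZWPair V Q μ∘ η∘ δ∘ ε∘ μ• η• δ• ε•) where

    open GHZWPair pair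
    private
      module GHZ = Frobenius ghz-cfa
      module W = Frobenius w-cfa
      module Wᶜ = IsCFA w-cfa
      module GHZᶜ = IsCFA ghz-cfa

    τ-transposes-pairing : (ε∘ ∘ μ∘) ∘ (τ ⊗₁ id) ≈ ε• ∘ μ•
    τ-transposes-pairing = transposeˡ-unbend GHZ.zigzagʳ

    τ-involutive : τ ∘ τ ≈ id
    τ-involutive = begin
      τ ∘ τ                                           ≈⟨ pair-α ⟩∘⟨refl ⟩
      transposeˡ (ε∘ ∘ μ∘) (δ• ∘ η•) ∘ τ              ≈⟨ transposeˡ-∘ ⟩
      transposeˡ ((ε∘ ∘ μ∘) ∘ (τ ⊗₁ id)) (δ• ∘ η•)    ≈⟨ refl⟩∘⟨ (τ-transposes-pairing ⟩⊗⟨ refl) ⟩∘⟨refl ⟩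
      transposeˡ (ε• ∘ μ•) (δ• ∘ η•)                  ≈⟨ W.zigzagˡ ⟩
      id                                              ∎

    ε•∘τ : ε• ∘ τ ≈ (ε∘ ∘ μ∘) ∘ (id ⊗₁ η•) ∘ unitorʳ⇐
    ε•∘τ = trans (refl⟩∘⟨ pair-α) (transposeˡ-postcompose (pullˡ Wᶜ.δ-counitʳ))

    τη•-copyable : Copyable δ∘ (τ ∘ η•)
    τη•-copyable = begin
      δ∘ ∘ τ ∘ η•                         ≈⟨ pullˡ pair-γ ⟩
      ((τ ⊗₁ τ) ∘ δ∘) ∘ η•                ≈⟨ trans assoc (refl⟩∘⟨ pair-β) ⟩
      (τ ⊗₁ τ) ∘ (η• ⊗₁ η•) ∘ unitorˡ⇐    ≈⟨ pullˡ (sym ⊗-homomorphism) ⟩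
      ((τ ∘ η•) ⊗₁ (τ ∘ η•)) ∘ unitorˡ⇐   ∎

    eigenvalue-η• : ∀ {ψ} → (ε∘ ∘ μ∘) ∘ (η• ⊗₁ ψ) ∘ unitorʳ⇐ ≈ ε• ∘ τ ∘ ψ
    eigenvalue-η• {ψ} = begin
      (ε∘ ∘ μ∘) ∘ (η• ⊗₁ ψ) ∘ unitorʳ⇐             ≈⟨ (refl⟩∘⟨ sym GHZᶜ.μ-comm) ⟩∘⟨refl ⟩
      (ε∘ ∘ μ∘ ∘ braiding) ∘ (η• ⊗₁ ψ) ∘ unitorʳ⇐  ≈⟨ trans (sym-assoc ⟩∘⟨refl)
                                                         (trans assoc (refl⟩∘⟨ pullˡ braiding-natural)) ⟩
      (ε∘ ∘ μ∘) ∘ ((ψ ⊗₁ η•) ∘ braiding) ∘ unitorʳ⇐ ≈⟨ refl⟩∘⟨ elimʳ braiding-unit ⟩∘⟨refl ⟩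
      (ε∘ ∘ μ∘) ∘ (ψ ⊗₁ η•) ∘ unitorʳ⇐             ≈⟨ refl⟩∘⟨ trans (serialize₂₁ ⟩∘⟨refl)
                                                         (trans assoc (refl⟩∘⟨ sym unitorʳ⇐-natural)) ⟩
      (ε∘ ∘ μ∘) ∘ (id ⊗₁ η•) ∘ unitorʳ⇐ ∘ ψ        ≈⟨ trans (refl⟩∘⟨ sym-assoc) sym-assoc ⟩
      ((ε∘ ∘ μ∘) ∘ (id ⊗₁ η•) ∘ unitorʳ⇐) ∘ ψ      ≈⟨ sym ε•∘τ ⟩∘⟨refl ⟩
      (ε• ∘ τ) ∘ ψ                                 ≈⟨ assoc ⟩
      ε• ∘ τ ∘ ψ                                   ∎

    eigenvalue-τη• : ∀ {ψ} → (ε∘ ∘ μ∘) ∘ ((τ ∘ η•) ⊗₁ ψ) ∘ unitorʳ⇐ ≈ ε• ∘ ψ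
    eigenvalue-τη• {ψ} = begin
      (ε∘ ∘ μ∘) ∘ ((τ ∘ η•) ⊗₁ ψ) ∘ unitorʳ⇐
        ≈⟨ refl⟩∘⟨ trans (trans (refl ⟩⊗⟨ sym identityˡ) ⊗-homomorphism ⟩∘⟨refl) assoc ⟩
      (ε∘ ∘ μ∘) ∘ (τ ⊗₁ id) ∘ (η• ⊗₁ ψ) ∘ unitorʳ⇐  ≈⟨ pullˡ τ-transposes-pairing ⟩
      (ε• ∘ μ•) ∘ (η• ⊗₁ ψ) ∘ unitorʳ⇐             ≈⟨ refl⟩∘⟨ serialize₁₂ ⟩∘⟨refl ⟩
      (ε• ∘ μ•) ∘ ((η• ⊗₁ id) ∘ (id ⊗₁ ψ)) ∘ unitorʳ⇐
        ≈⟨ trans assoc (refl⟩∘⟨ trans (refl⟩∘⟨ assoc) (pullˡ Wᶜ.μ-unitˡ)) ⟩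
      ε• ∘ unitorˡ⇒ ∘ (id ⊗₁ ψ) ∘ unitorʳ⇐         ≈⟨ refl⟩∘⟨ pullˡ (sym unitorˡ-natural) ⟩
      ε• ∘ (ψ ∘ unitorˡ⇒) ∘ unitorʳ⇐               ≈⟨ refl⟩∘⟨ trans assoc (elimʳ (trans
                                                         (unitorˡ≈unitorʳ ⟩∘⟨refl) unitorʳ-isoʳ)) ⟩
      ε• ∘ ψ                                       ∎

    Φ∘η• : ∀ {ψ} → Φ V μ∘ ψ ∘ η• ≈ η• ∘ ε• ∘ τ ∘ ψ
    Φ∘η• = trans (GHZ.Φ-copyable pair-β) (refl⟩∘⟨ eigenvalue-η•)

    Φ∘τη• : ∀ {ψ} → Φ V μ∘ ψ ∘ τ ∘ η• ≈ (τ ∘ η•) ∘ ε• ∘ ψ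
    Φ∘τη• = trans (GHZ.Φ-copyable τη•-copyable) (refl⟩∘⟨ eigenvalue-τη•)

    ττη• : τ ∘ τ ∘ η• ≈ η•
    ττη• = trans (pullˡ τ-involutive) identityˡ

    Φinv∘Φ-agrees-on-η•-τη• : ∀ {ψ} →
      let lhs = Φinv V μ∘ τ ψ ∘ Φ V μ∘ ψ
          rhs = (ε• ∘ ψ) ·ₛ (ε• ∘ τ ∘ ψ) ·ₛ id
      in (lhs ∘ η• ≈ rhs ∘ η•) × (lhs ∘ τ ∘ η• ≈ rhs ∘ τ ∘ η•)
    Φinv∘Φ-agrees-on-η•-τη• =
      trans (conjugate-eigenpoints refl ττη• Φ∘η• Φ∘τη•)
            (trans (refl⟩∘⟨ scalar-comm) (sym ·ₛ-·ₛ-id-point)) ,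
      trans (conjugate-eigenpoints ττη• refl Φ∘τη• Φ∘η•) (sym ·ₛ-·ₛ-id-point)

theorem3p3 : ∀ {o ℓ e : Level} (V : SymMonCat o ℓ e) →
    let open SymMonCat V in
    (Q : Obj)
    (μ∘ : (Q ⊗₀ Q) ⇒ Q) (η∘ : I ⇒ Q) (δ∘ : Q ⇒ (Q ⊗₀ Q)) (ε∘ : Q ⇒ I)
    (μ• : (Q ⊗₀ Q) ⇒ Q) (η• : I ⇒ Q) (δ• : Q ⇒ (Q ⊗₀ Q)) (ε• : Q ⇒ I) →
    GHZWPair V Q μ∘ η∘ δ∘ ε∘ μ• η• δ• ε• →
    IsPluggingSet₂ V η• (τ-map V μ• ε• δ∘ η∘ ∘ η•) →
    (ψ : I ⇒ Q) →
    Φinv V μ∘ (τ-map V μ• ε• δ∘ η∘) ψ ∘ Φ V μ∘ ψ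
      ≈ _·_ V (ε• ∘ ψ) (_·_ V (ε• ∘ τ-map V μ• ε• δ∘ η∘ ∘ ψ) id)
theorem3p3 V Q μ∘ η∘ δ∘ ε∘ μ• η• δ• ε• pair plugging ψ =
  proj₂ (plugging _ _) (GHZWPairProperties.Φinv∘Φ-agrees-on-η•-τη• V pair)
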